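{- Let $D$ be a digraph. If the girth of $D$ is at least $5$ (including the case that $D$ is acyclic), then there exists a temporization $\lambda: A(D)\to 2^{\mathbb{N}}\setminus\{\emptyset\}$ such that $(D,\lambda)$ contains no temporal weak-cycle; if the girth of $D$ is at most $3$, no such temporization exists.
   Context: $D$ is a finite simple digraph (no loops or parallel arcs; opposite arcs $uv,vu$ allowed). A cycle of $D$ is a closed directed path $(v_1,\dots,v_q,v_1)$ with $q\ge2$ and $v_1,\dots,v_q$ distinct; its length is $q$; the girth of $D$ is the minimum length of a cycle. Non-strict model: a temporal walk in $(D,\lambda)$ is a sequence $(v_1,t_1,v_2,\dots,v_q,t_q,v_{q+1})$ with $q\ge1$, $v_iv_{i+1}\in A(D)$, $t_i\in\lambda(v_iv_{i+1})$, and $t_1\le\dots\le t_q$. A temporal $x,y$-path is such a walk with $v_1=x$, $v_{q+1}=y$ and all vertices distinct, except that when $x=y$ we require $v_1=v_{q+1}$ and $v_1,\dots,v_q$ distinct; its arc set is $\{v_iv_{i+1}\}$. A cycle $C$ is a temporal weak-cycle if there exist $x,y\in V(C)$ (possibly equal), a temporal $x,y$-path $P$ and a temporal $y,x$-path $P'$ such that the union of the arc sets of $P$ and $P'$ equals the arc set of $C$. -}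

module Defs where

open import Level using (0ℓ)
open import Data.Nat using (ℕ; _≤_)
open import Data.Fin using (Fin)
open import Data.Bool using (Bool; true; false; T)
open import Data.Product using (Σ; ∃; _×_; _,_; proj₁)
open import Data.Sum using (_⊎_)
open import Data.List using (List; []; _∷_; _∷ʳ_; map; length)
open import Data.List.NonEmpty using (List⁺; _∷_; toList; head; last)
open import Data.List.Membership.Propositional using (_∈_)
open import Data.List.Relation.Unary.All using (All)
open import Data.List.Relation.Unary.Unique.Propositional using (Unique)
open import Data.Unit using (⊤)
open import Relation.Binary.PropositionalEquality using (_≡_)
open import Relation.Nullary using (¬_)
open import Function.Bundles using (_⇔_)

-- A finite simple digraph on vertex set Fin n: an adjacency relation
-- (at most one arc u→v, so no parallel arcs) without loops.
-- Opposite arcs uv and vu are allowed.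
record Digraph : Set where
  field
    n        : ℕ
    adj      : Fin n → Fin n → Bool
    loopless : ∀ v → adj v v ≡ false

  V : Set
  V = Fin n

  Arc : V → V → Set
  Arc u v = T (adj u v)

open Digraph public

pairs : {A : Set} → List A → List (A × A)
pairs []           = []
pairs (x ∷ [])     = []
pairs (x ∷ y ∷ xs) = (x , y) ∷ pairs (y ∷ xs)

module _ (D : Digraph) where

  cycleArcs : List (V D) → List (V D × V D)
  cycleArcs []       = []
  cycleArcs (v ∷ vs) = pairs ((v ∷ vs) ∷ʳ v)

  IsCycle : List (V D) → Set
  IsCycle vs = (2 ≤ length vs) × Unique vs
             × All (λ p → Arc D (Data.Product.proj₁ p) (Data.Product.proj₂ p)) (cycleArcs vs)

  GirthAtLeast5 : Set
  GirthAtLeast5 = ∀ vs → IsCycle vs → 5 ≤ length vs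

  GirthAtMost3 : Set
  GirthAtMost3 = Σ (List (V D)) λ vs → IsCycle vs × (length vs ≤ 3)

  record Temporization : Set₁ where
    field
      times    : (u v : V D) → Arc D u v → ℕ → Set
      nonempty : (u v : V D) (a : Arc D u v) → ∃ (times u v a)

  open Temporization public

  module _ (τ : Temporization) where

    record Step : Set where
      constructor step
      field
        from  : V D
        to    : V D
        arc   : Arc D from to
        time  : ℕ
        inλ   : times τ from to arc time

    open Step public

    Chain : List Step → Set
    Chain []           = ⊤
    Chain (s ∷ [])     = ⊤
    Chain (s ∷ s' ∷ r) = (to s ≡ from s') × (time s ≤ time s') × Chain (s' ∷ r)

    record TWalk : Set where
      field
        steps : List⁺ Step
        chain : Chain (toList steps)

      start end : V D
      start = from (head steps)
      end   = to (last steps)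

      sources : List (V D)
      sources = map from (toList steps)

      vertices : List (V D)
      vertices = sources ∷ʳ end

      arcSet : List (V D × V D)
      arcSet = map (λ s → from s , to s) (toList steps)

    open TWalk public

    TPath : V D → V D → Set
    TPath x y = Σ TWalk λ W →
        (start W ≡ x) × (end W ≡ y)
      × (¬ (x ≡ y) → Unique (vertices W))
      × (x ≡ y → Unique (sources W))

    TemporalWeakCycle : List (V D) → Set
    TemporalWeakCycle vs =
      IsCycle vs × Σ (V D) λ x → Σ (V D) λ y →
        (x ∈ vs) × (y ∈ vs) ×
        Σ (TPath x y) λ P → Σ (TPath y x) λ P' →
          ∀ (a : V D × V D) →
            (a ∈ cycleArcs vs) ⇔ ((a ∈ arcSet (proj₁ P)) ⊎ (a ∈ arcSet (proj₁ P')))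

    NoTemporalWeakCycle : Set
    NoTemporalWeakCycle = ∀ vs → ¬ TemporalWeakCycle vs

-- Label every arc u → v (vertices ranked 0 … n−1) by n − u if it ascends and by n + u if it
-- descends. Then two consecutive arcs of a temporal walk must ascend and then descend, so their
-- common vertex is a strict local maximum; two adjacent vertices cannot both be local maxima,
-- hence every temporal walk has at most two arcs and a weak-cycle, the union of two temporal
-- paths, has at most four arcs, fewer than any cycle of length at least five. Conversely, in a digon the two arcs are temporal paths, and going
-- around a triangle some time does not decrease from one arc to the next, giving a temporal
-- path of length two closed up by the third arc.
module Submission where

open import Defs
open import Data.Product using (Σ; ∃; _×_; _,_; proj₁; proj₂)
open import Data.Sum using (_⊎_; inj₁; inj₂)
open import Data.Empty using (⊥-elim)
open import Data.Unit using (tt)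
open import Data.Bool using (T)
open import Data.Nat using (ℕ; suc; _+_; _∸_; _≤_; _<_; z≤n; s≤s; _<?_; _≤?_)
open import Data.Nat.Properties
open import Data.Fin using (toℕ)
open import Data.Fin.Properties using (toℕ-injective; toℕ<n)
open import Data.List using (List; []; _∷_; _++_; _∷ʳ_; map; length)
open import Data.List.Properties using (length-map; length-++)
open import Data.List.NonEmpty using (_∷_; toList)
open import Data.List.Membership.Propositional using (_∈_)
open import Data.List.Membership.Propositional.Properties
  using (∈-∃++; ∈-++⁻; ∈-++⁺ˡ; ∈-++⁺ʳ; ++-∈⇔)
open import Data.List.Relation.Binary.Subset.Propositional using (_⊆_)
open import Data.List.Relation.Unary.Any using (here; there)
open import Data.List.Relation.Unary.All using (_∷_; [])
  renaming (lookup to All-lookup)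
open import Data.List.Relation.Unary.AllPairs using (_∷_; [])
open import Data.List.Relation.Unary.Unique.Propositional using (Unique)
open import Data.List.Relation.Unary.Unique.Propositional.Properties using (map⁻)
open import Relation.Nullary using (¬_; yes; no)
open import Relation.Binary.PropositionalEquality
open import Function.Base using (_∘_)
open import Function.Bundles using (_⇔_; Equivalence)

Unique-⊆⇒length≤ : {A : Set} {xs ys : List A} → Unique xs → xs ⊆ ys → length xs ≤ length ys
Unique-⊆⇒length≤ {xs = []} _ _ = z≤n
Unique-⊆⇒length≤ {xs = x ∷ xs} (x∉xs ∷ uniq) xs⊆ys with ∈-∃++ (xs⊆ys (here refl))
... | us , vs , refl = begin
  suc (length xs)             ≤⟨ s≤s (Unique-⊆⇒length≤ uniq xs⊆us++vs) ⟩
  suc (length (us ++ vs))     ≡⟨ cong suc (length-++ us) ⟩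
  suc (length us + length vs) ≡⟨ sym (+-suc (length us) (length vs)) ⟩
  length us + suc (length vs) ≡⟨ sym (length-++ us) ⟩
  length (us ++ x ∷ vs)       ∎
  where
  open ≤-Reasoning
  xs⊆us++vs : xs ⊆ us ++ vs
  xs⊆us++vs z∈xs with ∈-++⁻ us (xs⊆ys (there z∈xs))
  ... | inj₁ z∈us         = ∈-++⁺ˡ z∈us
  ... | inj₂ (here refl)  = ⊥-elim (All-lookup x∉xs z∈xs refl)
  ... | inj₂ (there z∈vs) = ∈-++⁺ʳ us z∈vs

pairs-∷ʳ-proj₁ : {A : Set} (xs : List A) (z : A) → map proj₁ (pairs (xs ∷ʳ z)) ≡ xs
pairs-∷ʳ-proj₁ []           z = refl
pairs-∷ʳ-proj₁ (a ∷ [])     z = refl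
pairs-∷ʳ-proj₁ (a ∷ b ∷ xs) z = cong (a ∷_) (pairs-∷ʳ-proj₁ (b ∷ xs) z)

cyclic-≤ : (a b c : ℕ) → a ≤ b ⊎ b ≤ c ⊎ c ≤ a
cyclic-≤ a b c with a ≤? b | b ≤? c
... | yes a≤b | _       = inj₁ a≤b
... | no _    | yes b≤c = inj₂ (inj₁ b≤c)
... | no a≰b  | no b≰c  = inj₂ (inj₂ (<⇒≤ (<-trans (≰⇒> b≰c) (≰⇒> a≰b))))

arcTime : ℕ → ℕ → ℕ → ℕ
arcTime N a b with a <? b
... | yes _ = N ∸ a
... | no _  = N + a

arcTime-≤⇒peak : ∀ N a b c → b ≤ N → a ≢ b → b ≢ c →
                 arcTime N a b ≤ arcTime N b c → a < b × c < b
arcTime-≤⇒peak N a b c b≤N a≢b b≢c le with a <? b | b <? c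
... | yes a<b | yes b<c = ⊥-elim (<⇒≱ (∸-monoʳ-< a<b b≤N) le)
... | yes a<b | no b≮c  = a<b , ≤∧≢⇒< (≮⇒≥ b≮c) (≢-sym b≢c)
... | no a≮b  | yes b<c =
  ⊥-elim (<⇒≱ (≤-<-trans (m∸n≤m N b) (m<m+n N (≤-<-trans z≤n b<a))) le)
  where b<a = ≤∧≢⇒< (≮⇒≥ a≮b) (≢-sym a≢b)
... | no a≮b  | no _    = ⊥-elim (<⇒≱ b<a (+-cancelˡ-≤ N _ _ le))
  where b<a = ≤∧≢⇒< (≮⇒≥ a≮b) (≢-sym a≢b)

module _ (D : Digraph) where

  Arc⇒≢ : ∀ {u v} → Arc D u v → u ≢ v
  Arc⇒≢ {u} uv refl = subst T (loopless D u) uv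

  cycleArcs-proj₁ : (vs : List (V D)) → map proj₁ (cycleArcs D vs) ≡ vs
  cycleArcs-proj₁ []       = refl
  cycleArcs-proj₁ (v ∷ vs) = pairs-∷ʳ-proj₁ (v ∷ vs) v

  length-cycleArcs : (vs : List (V D)) → length (cycleArcs D vs) ≡ length vs
  length-cycleArcs vs = trans (sym (length-map proj₁ (cycleArcs D vs))) (cong length (cycleArcs-proj₁ vs))

  Unique-cycleArcs : {vs : List (V D)} → Unique vs → Unique (cycleArcs D vs)
  Unique-cycleArcs {vs} uniq = map⁻ (subst Unique (sym (cycleArcs-proj₁ vs)) uniq)

  arcTimeTemporization : Temporization D
  arcTimeTemporization = record
    { times    = λ u v _ t → t ≡ arcTime (n D) (toℕ u) (toℕ v)
    ; nonempty = λ u v _ → arcTime (n D) (toℕ u) (toℕ v) , refl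
    }

  private
    τ₀ : Temporization D
    τ₀ = arcTimeTemporization

  consecutiveSteps-peak : ∀ {s s' : Step D τ₀} → to s ≡ from s' → time s ≤ time s' →
    toℕ (from s) < toℕ (from s') × toℕ (to s') < toℕ (from s')
  consecutiveSteps-peak {step u v uv _ refl} {step _ w vw _ refl} refl le =
    arcTime-≤⇒peak (n D) (toℕ u) (toℕ v) (toℕ w) (<⇒≤ (toℕ<n v))
      (Arc⇒≢ uv ∘ toℕ-injective) (Arc⇒≢ vw ∘ toℕ-injective) le

  Chain-length≤2 : (ss : List (Step D τ₀)) → Chain D τ₀ ss → length ss ≤ 2
  Chain-length≤2 []                 _ = z≤n
  Chain-length≤2 (_ ∷ [])           _ = s≤s z≤n
  Chain-length≤2 (_ ∷ _ ∷ [])       _ = s≤s (s≤s z≤n)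
  Chain-length≤2 (s₁ ∷ s₂ ∷ s₃@(step _ _ _ _ _) ∷ _) (e₁ , t₁ , refl , t₂ , _) =
    ⊥-elim (<-asym (proj₂ (consecutiveSteps-peak {s₁} {s₂} e₁ t₁))
                   (proj₁ (consecutiveSteps-peak {s₂} {s₃} refl t₂)))

  length-arcSet≤2 : (W : TWalk D τ₀) → length (arcSet W) ≤ 2
  length-arcSet≤2 W =
    subst (_≤ 2) (sym (length-map _ (toList (steps W)))) (Chain-length≤2 _ (chain W))

  girth≥5⇒noTemporalWeakCycle : GirthAtLeast5 D → NoTemporalWeakCycle D τ₀
  girth≥5⇒noTemporalWeakCycle girth vs
    (cyc@(_ , uniq , _) , _ , _ , _ , _ , (P , _) , (P' , _) , arcs⇔) =
    <⇒≱ (girth vs cyc) (begin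
      length vs                                  ≡⟨ sym (length-cycleArcs vs) ⟩
      length (cycleArcs D vs)                    ≤⟨ Unique-⊆⇒length≤ (Unique-cycleArcs uniq) covered ⟩
      length (arcSet P ++ arcSet P')             ≡⟨ length-++ (arcSet P) ⟩
      length (arcSet P) + length (arcSet P')     ≤⟨ +-mono-≤ (length-arcSet≤2 P) (length-arcSet≤2 P') ⟩
      4                                          ∎)
    where
    open ≤-Reasoning
    covered : cycleArcs D vs ⊆ arcSet P ++ arcSet P'
    covered {a} a∈C = Equivalence.from ++-∈⇔ (Equivalence.to (arcs⇔ a) a∈C)

module _ (D : Digraph) (τ : Temporization D) where

  someTime : ∀ {u v} → Arc D u v → ℕ
  someTime {u} {v} uv = proj₁ (nonempty τ u v uv)

  arcStep : ∀ {u v} → Arc D u v → Step D τ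
  arcStep {u} {v} uv = step u v uv (someTime uv) (proj₂ (nonempty τ u v uv))

  arcPath : ∀ {u v} → Arc D u v → TPath D τ u v
  arcPath uv =
    record { steps = arcStep uv ∷ [] ; chain = tt } , refl , refl ,
    (λ _ → (Arc⇒≢ D uv ∷ []) ∷ [] ∷ []) , (λ u≡v → ⊥-elim (Arc⇒≢ D uv u≡v))

  twoArcPath : ∀ {u v w} (uv : Arc D u v) (vw : Arc D v w) →
    someTime uv ≤ someTime vw → u ≢ w → TPath D τ u w
  twoArcPath uv vw le u≢w =
    record { steps = arcStep uv ∷ arcStep vw ∷ [] ; chain = refl , le , tt } , refl , refl ,
    (λ _ → (Arc⇒≢ D uv ∷ u≢w ∷ []) ∷ (Arc⇒≢ D vw ∷ []) ∷ [] ∷ []) , (λ u≡w → ⊥-elim (u≢w u≡w))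

  twoPaths⇒TemporalWeakCycle : ∀ {vs x y} → IsCycle D vs → x ∈ vs → y ∈ vs →
    (P : TPath D τ x y) (P' : TPath D τ y x) →
    cycleArcs D vs ≡ arcSet (proj₁ P) ++ arcSet (proj₁ P') → TemporalWeakCycle D τ vs
  twoPaths⇒TemporalWeakCycle cyc x∈ y∈ P P' arcs≡ =
    cyc , _ , _ , x∈ , y∈ , P , P' , λ a → subst (λ as → a ∈ as ⇔ _) (sym arcs≡) ++-∈⇔

  triangle-rotate : ∀ {a b c} → IsCycle D (a ∷ b ∷ c ∷ []) → IsCycle D (b ∷ c ∷ a ∷ [])
  triangle-rotate (len , (a≢b ∷ a≢c ∷ []) ∷ (b≢c ∷ []) ∷ [] ∷ [] , ab ∷ bc ∷ ca ∷ []) =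
    len , (b≢c ∷ ≢-sym a≢b ∷ []) ∷ (≢-sym a≢c ∷ []) ∷ [] ∷ [] , bc ∷ ca ∷ ab ∷ []

  triangle⇒TemporalWeakCycle : ∀ {a b c} → IsCycle D (a ∷ b ∷ c ∷ []) →
    (ab : Arc D a b) (bc : Arc D b c) → someTime ab ≤ someTime bc →
    TemporalWeakCycle D τ (a ∷ b ∷ c ∷ [])
  triangle⇒TemporalWeakCycle cyc@(_ , (_ ∷ a≢c ∷ []) ∷ _ , _ ∷ _ ∷ ca ∷ []) ab bc le =
    twoPaths⇒TemporalWeakCycle cyc (here refl) (there (there (here refl)))
      (twoArcPath ab bc le a≢c) (arcPath ca) refl

  shortCycle⇒TemporalWeakCycle : ∀ {vs} → IsCycle D vs → length vs ≤ 3 →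
    ∃ (TemporalWeakCycle D τ)
  shortCycle⇒TemporalWeakCycle {_ ∷ []} (s≤s () , _) _
  shortCycle⇒TemporalWeakCycle {_ ∷ _ ∷ _ ∷ _ ∷ _} _ (s≤s (s≤s (s≤s ())))
  shortCycle⇒TemporalWeakCycle {vs@(_ ∷ _ ∷ [])} cyc@(_ , _ , ab ∷ ba ∷ []) _ =
    vs , twoPaths⇒TemporalWeakCycle cyc (here refl) (there (here refl)) (arcPath ab) (arcPath ba) refl
  shortCycle⇒TemporalWeakCycle {_ ∷ _ ∷ _ ∷ []} cyc@(_ , _ , ab ∷ bc ∷ ca ∷ []) _
    with cyclic-≤ (someTime ab) (someTime bc) (someTime ca)
  ... | inj₁ le        = _ , triangle⇒TemporalWeakCycle cyc ab bc le
  ... | inj₂ (inj₁ le) = _ , triangle⇒TemporalWeakCycle (triangle-rotate cyc) bc ca le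
  ... | inj₂ (inj₂ le) = _ , triangle⇒TemporalWeakCycle (triangle-rotate (triangle-rotate cyc)) ca ab le

lemma4 : (D : Digraph) →
    (GirthAtLeast5 D → Σ (Temporization D) λ τ → NoTemporalWeakCycle D τ)
    × (GirthAtMost3 D → (τ : Temporization D) → ¬ NoTemporalWeakCycle D τ)
lemma4 D =
  (λ girth → arcTimeTemporization D , girth≥5⇒noTemporalWeakCycle D girth) ,
  (λ { (_ , cyc , short) τ noWeakCycle →
         let (vs , weakCycle) = shortCycle⇒TemporalWeakCycle D τ cyc short
         in noWeakCycle vs weakCycle })
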